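{- Let $\Sigma$ be a signed graph and let $\Sigma^\sim$ be the all-negative signed graph obtained from $\Sigma$ by negatively subdividing every positive edge. Then $l_0(\Sigma^\sim)=l_0(\Sigma)$ and $l(\Sigma^\sim)=l(\Sigma)$.
   Context: A signed graph $\Sigma=(\Gamma,\sigma)$ is a graph $\Gamma=(V,E)$ (loops and multiple edges allowed) with a signature $\sigma:E\to\{+,-\}$. A circle is a connected 2-regular subgraph; its sign is the product of its edge signs. $\Sigma$ is balanced if every circle is positive. The frustration index $l(\Sigma)$ is the smallest number of edges whose deletion leaves a balanced signed graph; the frustration number $l_0(\Sigma)$ is the smallest number of vertices whose deletion leaves a balanced signed graph. Negative subdivision of a positive edge means replacing it by a path of two negative edges through a new vertex; $\Sigma^\sim$ is obtained by negatively subdividing every positive edge of $\Sigma$. -}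

module Defs where

open import Data.Nat using (ℕ; zero; suc; _+_; _≤_)
open import Data.Fin using (Fin; zero; suc; _↑ʳ_; inject₁; fromℕ)
open import Data.Product using (Σ; _×_; _,_; ∃)
open import Data.Sum using (_⊎_)
open import Data.List using (List; []; _∷_; map; length; lookup)
open import Data.Sign using (Sign) renaming (_*_ to _⊛_; + to pos; - to neg)
open import Data.Fin.Subset using (Subset; _∉_; ∣_∣)
open import Function.Definitions using (Injective)
open import Relation.Binary.PropositionalEquality using (_≡_)

-- A signed edge on vertex set Fin n: (endpoint, endpoint, sign).
-- Loops (equal endpoints) and parallel edges are allowed.
Edge : ℕ → Set
Edge n = Fin n × Fin n × Sign

-- A (finite) signed graph: n vertices Fin n, and an edge list (edge
-- identities = positions in the list, so multiple edges are allowed).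
record SignedGraph : Set where
  constructor mkSG
  field
    nV    : ℕ
    edges : List (Edge nV)

open SignedGraph public

EdgeId : SignedGraph → Set
EdgeId G = Fin (length (edges G))

edgeAt : (G : SignedGraph) → EdgeId G → Edge (nV G)
edgeAt G e = lookup (edges G) e

src tgt : (G : SignedGraph) → EdgeId G → Fin (nV G)
src G e with edgeAt G e
... | (u , _ , _) = u
tgt G e with edgeAt G e
... | (_ , v , _) = v

sgn : (G : SignedGraph) → EdgeId G → Sign
sgn G e with edgeAt G e
... | (_ , _ , s) = s

Joins : (G : SignedGraph) → EdgeId G → Fin (nV G) → Fin (nV G) → Set
Joins G e x y = (src G e ≡ x × tgt G e ≡ y) ⊎ (src G e ≡ y × tgt G e ≡ x)

prodSign : (k : ℕ) → (Fin k → Sign) → Sign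
prodSign zero    f = pos
prodSign (suc k) f = f zero ⊛ prodSign k (λ i → f (suc i))

-- A circle (connected 2-regular subgraph) of length suc len, presented
-- cyclically: distinct vertices v_0,…,v_len and distinct edges e_0,…,e_len,
-- where e_i joins v_i and v_{i+1} (i < len) and e_len joins v_len and v_0.
-- len = 0 : a loop;  len = 1 : two distinct parallel edges (a digon).
record Circle (G : SignedGraph) : Set where
  field
    len    : ℕ
    vtx    : Fin (suc len) → Fin (nV G)
    edg    : Fin (suc len) → EdgeId G
    vtxInj : Injective _≡_ _≡_ vtx
    edgInj : Injective _≡_ _≡_ edg
    path   : (i : Fin len) → Joins G (edg (inject₁ i)) (vtx (inject₁ i)) (vtx (suc i))
    close  : Joins G (edg (fromℕ len)) (vtx (fromℕ len)) (vtx zero)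

open Circle public

circleSign : {G : SignedGraph} → Circle G → Sign
circleSign {G} C = prodSign (suc (len C)) (λ i → sgn G (edg C i))

Balanced : SignedGraph → Set
Balanced G = (C : Circle G) → circleSign C ≡ pos

-- The graph G minus the edge set D is balanced: every circle of G using
-- no edge of D (= every circle of G ∖ D) is positive.
BalancedDelEdges : (G : SignedGraph) → Subset (length (edges G)) → Set
BalancedDelEdges G D = (C : Circle G) → ((i : Fin (suc (len C))) → edg C i ∉ D) → circleSign C ≡ pos

-- The graph G minus the vertex set X (and all incident edges) is balanced:
-- every circle of G avoiding all vertices of X is positive.
BalancedDelVertices : (G : SignedGraph) → Subset (nV G) → Set
BalancedDelVertices G X = (C : Circle G) → ((i : Fin (suc (len C))) → vtx C i ∉ X) → circleSign C ≡ pos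

IsFrustrationIndex : SignedGraph → ℕ → Set
IsFrustrationIndex G k =
  (Σ (Subset (length (edges G))) λ D → ∣ D ∣ ≡ k × BalancedDelEdges G D)
  × ((D : Subset (length (edges G))) → BalancedDelEdges G D → k ≤ ∣ D ∣)

IsFrustrationNumber : SignedGraph → ℕ → Set
IsFrustrationNumber G k =
  (Σ (Subset (nV G)) λ X → ∣ X ∣ ≡ k × BalancedDelVertices G X)
  × ((X : Subset (nV G)) → BalancedDelVertices G X → k ≤ ∣ X ∣)

npos : {n : ℕ} → List (Edge n) → ℕ
npos []                  = 0
npos ((_ , _ , pos) ∷ es) = suc (npos es)
npos ((_ , _ , neg) ∷ es) = npos es

shiftEdge : {m : ℕ} → Edge m → Edge (suc m)
shiftEdge (u , v , s) = (suc u , suc v , s)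

-- New vertex set: Fin (npos es + n); the new subdivision vertices are
-- 0,…,npos es - 1 and the old vertex v is  (npos es ↑ʳ v).
subdivEdges : {n : ℕ} (es : List (Edge n)) → List (Edge (npos es + n))
subdivEdges []                    = []
subdivEdges {n} ((u , v , pos) ∷ es) =
  ((suc (npos es) ↑ʳ u) , zero , neg) ∷ (zero , (suc (npos es) ↑ʳ v) , neg)
    ∷ map shiftEdge (subdivEdges es)
subdivEdges {n} ((u , v , neg) ∷ es) =
  ((npos es ↑ʳ u) , (npos es ↑ʳ v) , neg) ∷ subdivEdges es

subdivide : SignedGraph → SignedGraph
subdivide G = mkSG (npos (edges G) + nV G) (subdivEdges (edges G))

-- Replacing every positive edge by its two negative halves turns each circle of Σ into a circle
-- of Σ~ of the same sign, and every circle of Σ~ arises in this way: the only edges at a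
-- subdivision vertex are the two halves of its edge, so a circle through it crosses the whole
-- edge. Along these correspondences a balancing set of either graph yields one of the other
-- graph that is no larger. From Σ to Σ~ keep the vertices and send an edge to its first half;
-- from Σ~ to Σ send a half to its edge and a subdivision vertex to an endpoint of its edge,
-- which lies on every circle through that vertex. Hence the minimum sizes agree.

module Submission where

open import Defs
open import Data.Nat using (ℕ; zero; suc; _+_; _≤_; z≤n; s≤s)
open import Data.Nat.Properties
  using (≤-trans; ≤-antisym; ≤-reflexive; +-monoʳ-≤; +-suc; module ≤-Reasoning)
open import Data.Fin as Fin using (Fin; zero; suc; inject₁; fromℕ; _↑ʳ_)
open import Data.Fin.Properties using (suc-injective; ↑ʳ-injective)
open import Data.Fin.Subset
  using (Subset; ∣_∣; ⊥; ⁅_⁆; _∪_; inside; outside)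
  renaming (_∈_ to _∈ₛ_; _∉_ to _∉ₛ_)
open import Data.Fin.Subset.Properties
  using (∣⊥∣≡0; ∣⁅x⁆∣≡1; x∈⁅x⁆; p⊆p∪q; q⊆p∪q; ∣p∣≤∣x∷p∣)
open import Data.Vec using ([]; _∷_; here; there)
open import Data.Product using (Σ; _×_; _,_; proj₁; proj₂)
open import Data.Sum as Sum using (_⊎_; inj₁; inj₂)
open import Data.Empty using (⊥-elim)
open import Data.List using (List; []; _∷_; _++_; _∷ʳ_; [_]; map; length; lookup; tabulate)
open import Data.List.Properties using (map-tabulate; map-++)
open import Data.List.Membership.Propositional using (_∈_; _∉_)
open import Data.List.Membership.Propositional.Properties using (∈-map⁺; ∈-lookup; ∈-++⁻)
open import Data.List.Relation.Unary.Any using (here; there)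
open import Data.List.Relation.Unary.All as All using (All; []; _∷_)
import Data.List.Relation.Unary.All.Properties as Allₚ
open import Data.List.Relation.Unary.AllPairs using ([]; _∷_)
open import Data.List.Relation.Unary.Unique.Propositional using (Unique)
open import Data.List.Relation.Unary.Unique.Propositional.Properties
  using (++⁺; Unique[x∷xs]⇒x∉xs) renaming (tabulate⁺ to unique-tabulate⁺)
open import Data.Sign using (Sign) renaming (_*_ to _⊛_; + to pos; - to neg)
open import Data.Sign.Properties using (*-assoc; *-comm; opposite-involutive)
open import Function using (_∘_)
open import Function.Bundles using (_⇔_; mk⇔)
open import Relation.Binary.PropositionalEquality
  using (_≡_; _≢_; refl; sym; trans; cong; cong₂; subst; module ≡-Reasoning)

private
  variable
    m n : ℕ

unique-∷ : {A : Set} {x : A} {xs : List A} → x ∉ xs → Unique xs → Unique (x ∷ xs)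
unique-∷ {xs = xs} x∉xs unique = Allₚ.¬Any⇒All¬ xs x∉xs ∷ unique

module _ {A B : Set} (f : A → B) where

  ∈-map-∷ʳ : (xs : List A) (y : A) {b : B} → b ∈ map f (xs ∷ʳ y) → b ∈ map f (y ∷ xs)
  ∈-map-∷ʳ xs y b∈ rewrite map-++ f xs [ y ] with ∈-++⁻ (map f xs) b∈
  ... | inj₁ b∈xs       = there b∈xs
  ... | inj₂ (here b≡y) = here b≡y

  unique-map-∷ʳ : (xs : List A) (y : A) → Unique (map f (y ∷ xs)) → Unique (map f (xs ∷ʳ y))
  unique-map-∷ʳ xs y (y∉xs ∷ xs-unique) rewrite map-++ f xs [ y ] =
    ++⁺ xs-unique ([] ∷ []) λ { (b∈xs , here b≡y) → All.lookup y∉xs b∈xs (sym b≡y) }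

  unique-map-tabulate : {k : ℕ} (h : Fin k → A) → (∀ {i j} → f (h i) ≡ f (h j) → i ≡ j) →
    Unique (map f (tabulate h))
  unique-map-tabulate h inj rewrite map-tabulate h f = unique-tabulate⁺ inj

  lookup-injective : (xs : List A) → Unique (map f xs) →
    ∀ {i j} → f (lookup xs i) ≡ f (lookup xs j) → i ≡ j
  lookup-injective (x ∷ xs) _            {zero}  {zero}  _  = refl
  lookup-injective (x ∷ xs) (x∉xs ∷ _)  {zero}  {suc j} eq =
    ⊥-elim (All.lookup x∉xs (∈-map⁺ f (∈-lookup j)) eq)
  lookup-injective (x ∷ xs) (x∉xs ∷ _)  {suc i} {zero}  eq =
    ⊥-elim (All.lookup x∉xs (∈-map⁺ f (∈-lookup i)) (sym eq))
  lookup-injective (x ∷ xs) (_ ∷ unique) {suc i} {suc j} eq = cong suc (lookup-injective xs unique eq)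

module _ {A B : Set} {f : A → B} where

  mapIndex : (xs : List A) → Fin (length xs) → Fin (length (map f xs))
  mapIndex (x ∷ xs) zero    = zero
  mapIndex (x ∷ xs) (suc i) = suc (mapIndex xs i)

  unmapIndex : (xs : List A) → Fin (length (map f xs)) → Fin (length xs)
  unmapIndex (x ∷ xs) zero    = zero
  unmapIndex (x ∷ xs) (suc i) = suc (unmapIndex xs i)

  lookup-mapIndex : (xs : List A) (i : Fin (length xs)) → lookup (map f xs) (mapIndex xs i) ≡ f (lookup xs i)
  lookup-mapIndex (x ∷ xs) zero    = refl
  lookup-mapIndex (x ∷ xs) (suc i) = lookup-mapIndex xs i

  unmapIndex-mapIndex : (xs : List A) (i : Fin (length xs)) → unmapIndex xs (mapIndex xs i) ≡ i
  unmapIndex-mapIndex (x ∷ xs) zero    = refl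
  unmapIndex-mapIndex (x ∷ xs) (suc i) = cong suc (unmapIndex-mapIndex xs i)

  mapIndex-unmapIndex : (xs : List A) (j : Fin (length (map f xs))) {i : Fin (length xs)} →
    unmapIndex xs j ≡ i → j ≡ mapIndex xs i
  mapIndex-unmapIndex (x ∷ xs) zero    refl = refl
  mapIndex-unmapIndex (x ∷ xs) (suc j) refl = cong suc (mapIndex-unmapIndex xs j refl)

∣p∪q∣≤∣p∣+∣q∣ : (p q : Subset n) → ∣ p ∪ q ∣ ≤ ∣ p ∣ + ∣ q ∣
∣p∪q∣≤∣p∣+∣q∣ []            []            = z≤n
∣p∪q∣≤∣p∣+∣q∣ (inside ∷ p)  (y ∷ q)       =
  s≤s (≤-trans (∣p∪q∣≤∣p∣+∣q∣ p q) (+-monoʳ-≤ ∣ p ∣ (∣p∣≤∣x∷p∣ y q)))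
∣p∪q∣≤∣p∣+∣q∣ (outside ∷ p) (inside ∷ q)  =
  ≤-trans (s≤s (∣p∪q∣≤∣p∣+∣q∣ p q)) (≤-reflexive (sym (+-suc ∣ p ∣ ∣ q ∣)))
∣p∪q∣≤∣p∣+∣q∣ (outside ∷ p) (outside ∷ q) = ∣p∪q∣≤∣p∣+∣q∣ p q

image : (Fin m → Fin n) → Subset m → Subset n
image f []            = ⊥
image f (inside ∷ p)  = ⁅ f zero ⁆ ∪ image (f ∘ suc) p
image f (outside ∷ p) = image (f ∘ suc) p

∣image∣≤∣p∣ : (f : Fin m → Fin n) (p : Subset m) → ∣ image f p ∣ ≤ ∣ p ∣
∣image∣≤∣p∣ {n = n} f [] = ≤-reflexive (∣⊥∣≡0 n)
∣image∣≤∣p∣ f (inside ∷ p) = begin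
  ∣ ⁅ f zero ⁆ ∪ q ∣     ≤⟨ ∣p∪q∣≤∣p∣+∣q∣ ⁅ f zero ⁆ q ⟩
  ∣ ⁅ f zero ⁆ ∣ + ∣ q ∣ ≡⟨ cong (_+ ∣ q ∣) (∣⁅x⁆∣≡1 (f zero)) ⟩
  suc ∣ q ∣              ≤⟨ s≤s (∣image∣≤∣p∣ (f ∘ suc) p) ⟩
  suc ∣ p ∣              ∎
  where
  open ≤-Reasoning
  q = image (f ∘ suc) p
∣image∣≤∣p∣ f (outside ∷ p) = ∣image∣≤∣p∣ (f ∘ suc) p

∈-image : (f : Fin m → Fin n) {p : Subset m} {x : Fin m} → x ∈ₛ p → f x ∈ₛ image f p
∈-image f here                      = p⊆p∪q _ (x∈⁅x⁆ (f zero))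
∈-image f {inside ∷ p}  (there x∈p) = q⊆p∪q ⁅ f zero ⁆ _ (∈-image (f ∘ suc) x∈p)
∈-image f {outside ∷ p} (there x∈p) = ∈-image (f ∘ suc) x∈p

All-∉-image : (f : Fin m → Fin n) {S : Subset m} {xs : List (Fin m)} {ys : List (Fin n)} →
  (∀ {a} → a ∈ xs → f a ∈ ys) → All (_∉ₛ image f S) ys → All (_∉ₛ S) xs
All-∉-image f xs⇒ys ys∉ = All.tabulate λ a∈xs a∈S → All.lookup ys∉ (xs⇒ys a∈xs) (∈-image f a∈S)

MinimumSize : (Subset n → Set) → ℕ → Set
MinimumSize {n} P k = (Σ (Subset n) λ X → ∣ X ∣ ≡ k × P X) × ((X : Subset n) → P X → k ≤ ∣ X ∣)

_⊑_ : (Subset m → Set) → (Subset n → Set) → Set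
_⊑_ {m} {n} P Q = (X : Subset m) → P X → Σ (Subset n) λ Y → ∣ Y ∣ ≤ ∣ X ∣ × Q Y

minimumSize-transfer : {P : Subset m → Set} {Q : Subset n → Set} {k : ℕ} →
  P ⊑ Q → Q ⊑ P → MinimumSize P k → MinimumSize Q k
minimumSize-transfer {Q = Q} {k} P⊑Q Q⊑P ((X , ∣X∣≡k , PX) , P-min) with P⊑Q X PX
... | Y , ∣Y∣≤∣X∣ , QY =
  (Y , ≤-antisym (subst (∣ Y ∣ ≤_) ∣X∣≡k ∣Y∣≤∣X∣) (Q-min Y QY) , QY) , Q-min
  where
  Q-min : (Z : Subset _) → Q Z → k ≤ ∣ Z ∣
  Q-min Z QZ with Q⊑P Z QZ
  ... | W , ∣W∣≤∣Z∣ , PW = ≤-trans (P-min W PW) ∣W∣≤∣Z∣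

-- Walks and circles

-- A step (v , e) leaves the vertex v along the edge e.
Step : SignedGraph → Set
Step G = Fin (nV G) × EdgeId G

data Walk (G : SignedGraph) : Fin (nV G) → List (Step G) → Fin (nV G) → Set where
  []  : {v : Fin (nV G)} → Walk G v [] v
  _∷_ : {v u t : Fin (nV G)} {e : EdgeId G} {xs : List (Step G)} →
        Joins G e v u → Walk G u xs t → Walk G v ((v , e) ∷ xs) t

signOf : (G : SignedGraph) → List (Step G) → Sign
signOf G []             = pos
signOf G ((_ , e) ∷ xs) = sgn G e ⊛ signOf G xs

module _ {G : SignedGraph} where

  joins-sym : {e : EdgeId G} {a b : Fin (nV G)} → Joins G e a b → Joins G e b a
  joins-sym (inj₁ ends) = inj₂ ends
  joins-sym (inj₂ ends) = inj₁ ends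

  joins-endpoint : {e : EdgeId G} {a b : Fin (nV G)} → Joins G e a b → src G e ≡ a ⊎ tgt G e ≡ a
  joins-endpoint (inj₁ (s≡a , _)) = inj₁ s≡a
  joins-endpoint (inj₂ (_ , t≡a)) = inj₂ t≡a

  joins-tgt : {e : EdgeId G} {a b : Fin (nV G)} → Joins G e a b → src G e ≡ a → tgt G e ≡ b
  joins-tgt (inj₁ (_ , t≡b))   _   = t≡b
  joins-tgt (inj₂ (s≡b , t≡a)) s≡a = trans t≡a (trans (sym s≡a) s≡b)

  joins-src : {e : EdgeId G} {a b : Fin (nV G)} → Joins G e a b → tgt G e ≡ a → src G e ≡ b
  joins-src (inj₁ (s≡a , t≡b)) t≡a = trans s≡a (trans (sym t≡a) t≡b)
  joins-src (inj₂ (s≡b , _))   _   = s≡b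

  walk-[] : {a b : Fin (nV G)} → Walk G a [] b → a ≡ b
  walk-[] [] = refl

  walk-∷ : {a b v : Fin (nV G)} {e : EdgeId G} {xs : List (Step G)} → Walk G a ((v , e) ∷ xs) b →
    v ≡ a × Σ (Fin (nV G)) λ u → Joins G e v u × Walk G u xs b
  walk-∷ (j ∷ w) = refl , _ , j , w

  walk-++ : {a b c : Fin (nV G)} {xs ys : List (Step G)} → Walk G a xs b → Walk G b ys c → Walk G a (xs ++ ys) c
  walk-++ []      w′ = w′
  walk-++ (j ∷ w) w′ = j ∷ walk-++ w w′

  walk-start : {a b : Fin (nV G)} {xs : List (Step G)} → Walk G a xs b → a ∈ map proj₁ xs ⊎ a ≡ b
  walk-start []      = inj₂ refl
  walk-start (_ ∷ _) = inj₁ (here refl)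

  src-∈-walk : {a b : Fin (nV G)} {xs : List (Step G)} {e : EdgeId G} → Walk G a xs b →
    e ∈ map proj₂ xs → src G e ∈ map proj₁ xs ⊎ src G e ≡ b
  src-∈-walk (inj₁ (s≡v , _) ∷ w) (here refl) = inj₁ (here s≡v)
  src-∈-walk (inj₂ (s≡u , _) ∷ w) (here refl) with walk-start w
  ... | inj₁ u∈w = inj₁ (there (subst (_∈ _) (sym s≡u) u∈w))
  ... | inj₂ u≡b = inj₂ (trans s≡u u≡b)
  src-∈-walk (_ ∷ w) (there e∈w) with src-∈-walk w e∈w
  ... | inj₁ s∈w = inj₁ (there s∈w)
  ... | inj₂ s≡b = inj₂ s≡b

  src-∈-closed : {a : Fin (nV G)} {y : Step G} {ys : List (Step G)} {e : EdgeId G} →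
    Walk G a (y ∷ ys) a → e ∈ map proj₂ (y ∷ ys) → src G e ∈ map proj₁ (y ∷ ys)
  src-∈-closed w e∈ with src-∈-walk w e∈
  ... | inj₁ src∈ = src∈
  ... | inj₂ src≡a = here (trans src≡a (sym (proj₁ (walk-∷ w))))

  signOf-∷ʳ : (xs : List (Step G)) (y : Step G) → signOf G (xs ∷ʳ y) ≡ signOf G (y ∷ xs)
  signOf-∷ʳ []             y = refl
  signOf-∷ʳ ((_ , e) ∷ xs) y = begin
    sgn G e ⊛ signOf G (xs ∷ʳ y)              ≡⟨ cong (sgn G e ⊛_) (signOf-∷ʳ xs y) ⟩
    sgn G e ⊛ (sgn G (proj₂ y) ⊛ signOf G xs) ≡⟨ sym (*-assoc (sgn G e) _ _) ⟩
    (sgn G e ⊛ sgn G (proj₂ y)) ⊛ signOf G xs ≡⟨ cong (_⊛ signOf G xs) (*-comm (sgn G e) _) ⟩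
    (sgn G (proj₂ y) ⊛ sgn G e) ⊛ signOf G xs ≡⟨ *-assoc (sgn G (proj₂ y)) _ _ ⟩
    sgn G (proj₂ y) ⊛ (sgn G e ⊛ signOf G xs) ∎
    where open ≡-Reasoning

record Cycle (G : SignedGraph) : Set where
  constructor cycle
  field
    start           : Fin (nV G)
    first           : Step G
    rest            : List (Step G)
    closed          : Walk G start (first ∷ rest) start
    vertices-unique : Unique (map proj₁ (first ∷ rest))
    edges-unique    : Unique (map proj₂ (first ∷ rest))

  steps : List (Step G)
  steps = first ∷ rest

open Cycle public

module _ {G : SignedGraph} where

  walk-tabulate : {k : ℕ} (f : Fin (suc k) → Fin (nV G)) (g : Fin (suc k) → EdgeId G) {t : Fin (nV G)} →
    ((i : Fin k) → Joins G (g (inject₁ i)) (f (inject₁ i)) (f (suc i))) →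
    Joins G (g (fromℕ k)) (f (fromℕ k)) t →
    Walk G (f zero) (tabulate (λ i → f i , g i)) t
  walk-tabulate {zero}  f g path close = close ∷ []
  walk-tabulate {suc k} f g path close =
    path zero ∷ walk-tabulate (f ∘ suc) (g ∘ suc) (path ∘ suc) close

  walk-lookup-path : {s t : Fin (nV G)} {y : Step G} {ys : List (Step G)} → Walk G s (y ∷ ys) t →
    (i : Fin (length ys)) → let xs = y ∷ ys in
    Joins G (proj₂ (lookup xs (inject₁ i))) (proj₁ (lookup xs (inject₁ i))) (proj₁ (lookup xs (suc i)))
  walk-lookup-path {ys = _ ∷ _} (j ∷ (_ ∷ _)) zero    = j
  walk-lookup-path {ys = _ ∷ _} (_ ∷ w)       (suc i) = walk-lookup-path w i

  walk-lookup-close : {s t : Fin (nV G)} {y : Step G} {ys : List (Step G)} → Walk G s (y ∷ ys) t →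
    let xs = y ∷ ys; i = fromℕ (length ys) in Joins G (proj₂ (lookup xs i)) (proj₁ (lookup xs i)) t
  walk-lookup-close {ys = []}    (j ∷ []) = j
  walk-lookup-close {ys = _ ∷ _} (_ ∷ w)  = walk-lookup-close w

  signOf-tabulate : {k : ℕ} (h : Fin k → Step G) → signOf G (tabulate h) ≡ prodSign k (sgn G ∘ proj₂ ∘ h)
  signOf-tabulate {zero}  h = refl
  signOf-tabulate {suc k} h = cong (sgn G (proj₂ (h zero)) ⊛_) (signOf-tabulate (h ∘ suc))

  signOf-lookup : (xs : List (Step G)) → prodSign (length xs) (sgn G ∘ proj₂ ∘ lookup xs) ≡ signOf G xs
  signOf-lookup []       = refl
  signOf-lookup (x ∷ xs) = cong (sgn G (proj₂ x) ⊛_) (signOf-lookup xs)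

  toCycle : Circle G → Cycle G
  toCycle C = cycle (vtx C zero) (step zero) (tabulate (step ∘ suc))
    (walk-tabulate (vtx C) (edg C) (path C) (close C))
    (unique-map-tabulate proj₁ step (vtxInj C))
    (unique-map-tabulate proj₂ step (edgInj C))
    where
    step : Fin (suc (len C)) → Step G
    step i = vtx C i , edg C i

  toCircle : Cycle G → Circle G
  toCircle c = record
    { len    = length (rest c)
    ; vtx    = proj₁ ∘ lookup (steps c)
    ; edg    = proj₂ ∘ lookup (steps c)
    ; vtxInj = lookup-injective proj₁ (steps c) (vertices-unique c)
    ; edgInj = lookup-injective proj₂ (steps c) (edges-unique c)
    ; path   = walk-lookup-path (closed c)
    ; close  = subst (Joins G _ _) (sym (proj₁ (walk-∷ (closed c)))) (walk-lookup-close (closed c))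
    }

-- BalancedDelVertices G X is PositiveCircles G proj₁ X, and BalancedDelEdges G D is
-- PositiveCircles G proj₂ D.
PositiveCircles : (G : SignedGraph) → (Step G → Fin m) → Subset m → Set
PositiveCircles G π S =
  (C : Circle G) → ((i : Fin (suc (len C))) → π (vtx C i , edg C i) ∉ₛ S) → circleSign C ≡ pos

PositiveCycles : (G : SignedGraph) → (Step G → Fin m) → Subset m → Set
PositiveCycles G π S = (c : Cycle G) → All (_∉ₛ S) (map π (steps c)) → signOf G (steps c) ≡ pos

module _ {G : SignedGraph} (π : Step G → Fin m) {S : Subset m} where

  positiveCircles⇒positiveCycles : PositiveCircles G π S → PositiveCycles G π S
  positiveCircles⇒positiveCycles circles-pos c avoids =
    trans (sym (signOf-lookup {G = G} (steps c)))
          (circles-pos (toCircle c) λ i → All.lookup (Allₚ.map⁻ avoids) (∈-lookup i))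

  positiveCycles⇒positiveCircles : PositiveCycles G π S → PositiveCircles G π S
  positiveCycles⇒positiveCircles cycles-pos C avoids =
    trans (sym (signOf-tabulate {G = G} (λ i → vtx C i , edg C i)))
          (cycles-pos (toCycle C) (Allₚ.map⁺ (Allₚ.tabulate⁺ avoids)))

-- Transporting balancing sets along cycle transfers

CarriedBy : (G H : SignedGraph) → (Fin (nV G) → Fin (nV H)) → (EdgeId G → EdgeId H) →
  List (Step G) → List (Step H) → Set
CarriedBy G H φ ψ xs ys =
  signOf G xs ≡ signOf H ys
  × (∀ {v} → v ∈ map proj₁ xs → φ v ∈ map proj₁ ys)
  × (∀ {e} → e ∈ map proj₂ xs → ψ e ∈ map proj₂ ys)

carriedBy-∷ʳ : {G H : SignedGraph} {φ : Fin (nV G) → Fin (nV H)} {ψ : EdgeId G → EdgeId H}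
  {xs : List (Step G)} (ys : List (Step H)) (y : Step H) →
  CarriedBy G H φ ψ xs (ys ∷ʳ y) → CarriedBy G H φ ψ xs (y ∷ ys)
carriedBy-∷ʳ {H = H} ys y (sign≡ , vertices , edges) =
  trans sign≡ (signOf-∷ʳ {G = H} ys y) , ∈-map-∷ʳ proj₁ ys y ∘ vertices , ∈-map-∷ʳ proj₂ ys y ∘ edges

record CycleTransfer (H G : SignedGraph) : Set where
  field
    vertexMap : Fin (nV G) → Fin (nV H)
    edgeMap   : EdgeId G → EdgeId H
    transfer  : (c : Cycle H) → Σ (Cycle G) λ d → CarriedBy G H vertexMap edgeMap (steps d) (steps c)

module _ {H G : SignedGraph} (T : CycleTransfer H G) where
  open CycleTransfer T

  balancedDelVertices-⊑ : BalancedDelVertices G ⊑ BalancedDelVertices H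
  balancedDelVertices-⊑ X balanced =
    image vertexMap X , ∣image∣≤∣p∣ vertexMap X , positiveCycles⇒positiveCircles proj₁ positive
    where
    positive : PositiveCycles H proj₁ (image vertexMap X)
    positive c avoids with transfer c
    ... | d , sign≡ , vertices , _ =
      trans (sym sign≡) (positiveCircles⇒positiveCycles proj₁ balanced d (All-∉-image vertexMap vertices avoids))

  balancedDelEdges-⊑ : BalancedDelEdges G ⊑ BalancedDelEdges H
  balancedDelEdges-⊑ D balanced =
    image edgeMap D , ∣image∣≤∣p∣ edgeMap D , positiveCycles⇒positiveCircles proj₂ positive
    where
    positive : PositiveCycles H proj₂ (image edgeMap D)
    positive c avoids with transfer c
    ... | d , sign≡ , _ , edges =
      trans (sym sign≡) (positiveCircles⇒positiveCycles proj₂ balanced d (All-∉-image edgeMap edges avoids))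

module _ {n : ℕ} where

  Positive : (es : List (Edge n)) → Fin (length es) → Set
  Positive es i = sgn (mkSG n es) i ≡ pos

  old : (es : List (Edge n)) → Fin n → Fin (npos es + n)
  old es v = npos es ↑ʳ v

  -- A negative edge is not subdivided: its midpoint is junk and its two halves coincide.
  midpoint : (es : List (Edge n)) → Fin (length es) → Fin (npos es + n)
  midpoint ((_ , _ , pos) ∷ es) zero    = zero
  midpoint ((_ , _ , pos) ∷ es) (suc i) = suc (midpoint es i)
  midpoint ((u , _ , neg) ∷ es) zero    = old es u
  midpoint ((_ , _ , neg) ∷ es) (suc i) = midpoint es i

  half₁ half₂ : (es : List (Edge n)) → Fin (length es) → Fin (length (subdivEdges es))
  half₁ ((_ , _ , pos) ∷ es) zero    = zero
  half₁ ((_ , _ , pos) ∷ es) (suc i) = suc (suc (mapIndex (subdivEdges es) (half₁ es i)))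
  half₁ ((_ , _ , neg) ∷ es) zero    = zero
  half₁ ((_ , _ , neg) ∷ es) (suc i) = suc (half₁ es i)
  half₂ ((_ , _ , pos) ∷ es) zero    = suc zero
  half₂ ((_ , _ , pos) ∷ es) (suc i) = suc (suc (mapIndex (subdivEdges es) (half₂ es i)))
  half₂ ((_ , _ , neg) ∷ es) zero    = zero
  half₂ ((_ , _ , neg) ∷ es) (suc i) = suc (half₂ es i)

  parent : (es : List (Edge n)) → Fin (length (subdivEdges es)) → Fin (length es)
  parent ((_ , _ , pos) ∷ es) zero          = zero
  parent ((_ , _ , pos) ∷ es) (suc zero)    = zero
  parent ((_ , _ , pos) ∷ es) (suc (suc j)) = suc (parent es (unmapIndex (subdivEdges es) j))
  parent ((_ , _ , neg) ∷ es) zero          = zero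
  parent ((_ , _ , neg) ∷ es) (suc j)       = suc (parent es j)

  lookup-half₁-neg : (es : List (Edge n)) (i : Fin (length es)) {u v : Fin n} → lookup es i ≡ (u , v , neg) →
    lookup (subdivEdges es) (half₁ es i) ≡ (old es u , old es v , neg)
  lookup-half₁-neg ((_ , _ , neg) ∷ es) zero    refl = refl
  lookup-half₁-neg ((_ , _ , pos) ∷ es) (suc i) eq
    rewrite lookup-mapIndex {f = shiftEdge} (subdivEdges es) (half₁ es i) | lookup-half₁-neg es i eq = refl
  lookup-half₁-neg ((_ , _ , neg) ∷ es) (suc i) eq = lookup-half₁-neg es i eq

  lookup-half₁-pos : (es : List (Edge n)) (i : Fin (length es)) {u v : Fin n} → lookup es i ≡ (u , v , pos) →
    lookup (subdivEdges es) (half₁ es i) ≡ (old es u , midpoint es i , neg)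
  lookup-half₁-pos ((_ , _ , pos) ∷ es) zero    refl = refl
  lookup-half₁-pos ((_ , _ , pos) ∷ es) (suc i) eq
    rewrite lookup-mapIndex {f = shiftEdge} (subdivEdges es) (half₁ es i) | lookup-half₁-pos es i eq = refl
  lookup-half₁-pos ((_ , _ , neg) ∷ es) (suc i) eq = lookup-half₁-pos es i eq

  lookup-half₂-pos : (es : List (Edge n)) (i : Fin (length es)) {u v : Fin n} → lookup es i ≡ (u , v , pos) →
    lookup (subdivEdges es) (half₂ es i) ≡ (midpoint es i , old es v , neg)
  lookup-half₂-pos ((_ , _ , pos) ∷ es) zero    refl = refl
  lookup-half₂-pos ((_ , _ , pos) ∷ es) (suc i) eq
    rewrite lookup-mapIndex {f = shiftEdge} (subdivEdges es) (half₂ es i) | lookup-half₂-pos es i eq = refl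
  lookup-half₂-pos ((_ , _ , neg) ∷ es) (suc i) eq = lookup-half₂-pos es i eq

  parent-half₁ : (es : List (Edge n)) (i : Fin (length es)) → parent es (half₁ es i) ≡ i
  parent-half₁ ((_ , _ , pos) ∷ es) zero = refl
  parent-half₁ ((_ , _ , pos) ∷ es) (suc i)
    rewrite unmapIndex-mapIndex {f = shiftEdge} (subdivEdges es) (half₁ es i) = cong suc (parent-half₁ es i)
  parent-half₁ ((_ , _ , neg) ∷ es) zero    = refl
  parent-half₁ ((_ , _ , neg) ∷ es) (suc i) = cong suc (parent-half₁ es i)

  parent-half₂ : (es : List (Edge n)) (i : Fin (length es)) → parent es (half₂ es i) ≡ i
  parent-half₂ ((_ , _ , pos) ∷ es) zero = refl
  parent-half₂ ((_ , _ , pos) ∷ es) (suc i)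
    rewrite unmapIndex-mapIndex {f = shiftEdge} (subdivEdges es) (half₂ es i) = cong suc (parent-half₂ es i)
  parent-half₂ ((_ , _ , neg) ∷ es) zero    = refl
  parent-half₂ ((_ , _ , neg) ∷ es) (suc i) = cong suc (parent-half₂ es i)

  half-cover : (es : List (Edge n)) (j : Fin (length (subdivEdges es))) →
    (Σ (Fin (length es)) λ i → j ≡ half₁ es i)
    ⊎ (Σ (Fin (length es)) λ i → Positive es i × j ≡ half₂ es i)
  half-cover ((_ , _ , pos) ∷ es) zero          = inj₁ (zero , refl)
  half-cover ((_ , _ , pos) ∷ es) (suc zero)    = inj₂ (zero , refl , refl)
  half-cover ((_ , _ , pos) ∷ es) (suc (suc j)) with half-cover es (unmapIndex (subdivEdges es) j)
  ... | inj₁ (i , eq)     = inj₁ (suc i , cong (Fin.suc ∘ Fin.suc) (mapIndex-unmapIndex (subdivEdges es) j eq))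
  ... | inj₂ (i , p , eq) = inj₂ (suc i , p , cong (Fin.suc ∘ Fin.suc) (mapIndex-unmapIndex (subdivEdges es) j eq))
  half-cover ((_ , _ , neg) ∷ es) zero          = inj₁ (zero , refl)
  half-cover ((_ , _ , neg) ∷ es) (suc j) with half-cover es j
  ... | inj₁ (i , eq)     = inj₁ (suc i , cong suc eq)
  ... | inj₂ (i , p , eq) = inj₂ (suc i , p , cong suc eq)

  old-injective : (es : List (Edge n)) {a b : Fin n} → old es a ≡ old es b → a ≡ b
  old-injective es = ↑ʳ-injective (npos es) _ _

  old≢midpoint : (es : List (Edge n)) (i : Fin (length es)) {v : Fin n} → Positive es i →
    old es v ≢ midpoint es i
  old≢midpoint ((_ , _ , pos) ∷ es) zero    p ()
  old≢midpoint ((_ , _ , pos) ∷ es) (suc i) p eq = old≢midpoint es i p (suc-injective eq)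
  old≢midpoint ((_ , _ , neg) ∷ es) (suc i) p eq = old≢midpoint es i p eq

  midpoint-injective : (es : List (Edge n)) {i j : Fin (length es)} → Positive es i → Positive es j →
    midpoint es i ≡ midpoint es j → i ≡ j
  midpoint-injective ((_ , _ , pos) ∷ es) {zero}  {zero}  _  _  _  = refl
  midpoint-injective ((_ , _ , pos) ∷ es) {suc i} {suc j} pi pj eq =
    cong suc (midpoint-injective es pi pj (suc-injective eq))
  midpoint-injective ((_ , _ , neg) ∷ es) {suc i} {suc j} pi pj eq = cong suc (midpoint-injective es pi pj eq)

  vertex-cover : (es : List (Edge n)) (x : Fin (npos es + n)) →
    (Σ (Fin n) λ v → x ≡ old es v) ⊎ (Σ (Fin (length es)) λ i → Positive es i × x ≡ midpoint es i)
  vertex-cover []                    x       = inj₁ (x , refl)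
  vertex-cover ((_ , _ , pos) ∷ es) zero    = inj₂ (zero , refl , refl)
  vertex-cover ((_ , _ , pos) ∷ es) (suc x) with vertex-cover es x
  ... | inj₁ (v , eq)     = inj₁ (v , cong suc eq)
  ... | inj₂ (i , p , eq) = inj₂ (suc i , p , cong suc eq)
  vertex-cover ((_ , _ , neg) ∷ es) x with vertex-cover es x
  ... | inj₁ (v , eq)     = inj₁ (v , eq)
  ... | inj₂ (i , p , eq) = inj₂ (suc i , p , eq)

-- Circles of Σ and of Σ~

module Subdivision (G : SignedGraph) where

  G~ : SignedGraph
  G~ = subdivide G

  private
    es : List (Edge (nV G))
    es = edges G

    variable
      v     : Fin (nV G)
      e     : EdgeId G
      xs    : List (Step G)
      ys    : List (Step G~)

  module _ {e : EdgeId G} where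

    edge-half₁-neg : sgn G e ≡ neg → edgeAt G~ (half₁ es e) ≡ (old es (src G e) , old es (tgt G e) , neg)
    edge-half₁-neg h = lookup-half₁-neg es e (cong (λ s → src G e , tgt G e , s) h)

    edge-half₁-pos : sgn G e ≡ pos → edgeAt G~ (half₁ es e) ≡ (old es (src G e) , midpoint es e , neg)
    edge-half₁-pos h = lookup-half₁-pos es e (cong (λ s → src G e , tgt G e , s) h)

    edge-half₂-pos : sgn G e ≡ pos → edgeAt G~ (half₂ es e) ≡ (midpoint es e , old es (tgt G e) , neg)
    edge-half₂-pos h = lookup-half₂-pos es e (cong (λ s → src G e , tgt G e , s) h)

    src-half₁ : src G~ (half₁ es e) ≡ old es (src G e)
    src-half₁ with sgn G e in h
    ... | pos = cong proj₁ (edge-half₁-pos h)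
    ... | neg = cong proj₁ (edge-half₁-neg h)

    tgt-half₁-neg : sgn G e ≡ neg → tgt G~ (half₁ es e) ≡ old es (tgt G e)
    tgt-half₁-neg h = cong (proj₁ ∘ proj₂) (edge-half₁-neg h)

    tgt-half₁-pos : sgn G e ≡ pos → tgt G~ (half₁ es e) ≡ midpoint es e
    tgt-half₁-pos h = cong (proj₁ ∘ proj₂) (edge-half₁-pos h)

    src-half₂-pos : sgn G e ≡ pos → src G~ (half₂ es e) ≡ midpoint es e
    src-half₂-pos h = cong proj₁ (edge-half₂-pos h)

    tgt-half₂-pos : sgn G e ≡ pos → tgt G~ (half₂ es e) ≡ old es (tgt G e)
    tgt-half₂-pos h = cong (proj₁ ∘ proj₂) (edge-half₂-pos h)

    sgn-half₁ : sgn G~ (half₁ es e) ≡ neg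
    sgn-half₁ with sgn G e in h
    ... | pos = cong (proj₂ ∘ proj₂) (edge-half₁-pos h)
    ... | neg = cong (proj₂ ∘ proj₂) (edge-half₁-neg h)

    half₁≢half₂ : sgn G e ≡ pos → half₁ es e ≢ half₂ es e
    half₁≢half₂ h eq =
      old≢midpoint es e h (trans (sym src-half₁) (trans (cong (src G~) eq) (src-half₂-pos h)))

  sgn-subdivide : (x : EdgeId G~) → sgn G~ x ≡ neg
  sgn-subdivide x with half-cover es x
  ... | inj₁ (_ , refl)     = sgn-half₁
  ... | inj₂ (_ , p , refl) = cong (proj₂ ∘ proj₂) (edge-half₂-pos p)

  joins-half₁-neg : {a b : Fin (nV G)} → sgn G e ≡ neg → Joins G e a b →
    Joins G~ (half₁ es e) (old es a) (old es b)
  joins-half₁-neg {e} h = Sum.map lift lift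
    where
    lift : ∀ {c d} → src G e ≡ c × tgt G e ≡ d →
      src G~ (half₁ es e) ≡ old es c × tgt G~ (half₁ es e) ≡ old es d
    lift (s≡ , t≡) = trans src-half₁ (cong (old es) s≡) , trans (tgt-half₁-neg h) (cong (old es) t≡)

  ≡old⇒≢midpoint : {u : Fin (nV G~)} {c : Fin (nV G)} → u ≡ old es c → sgn G e ≡ pos → u ≢ midpoint es e
  ≡old⇒≢midpoint refl p = old≢midpoint es _ p

  old-endpoints : {x : EdgeId G~} {a b : Fin (nV G)} → Joins G~ x (old es a) (old es b) →
    sgn G e ≡ pos → src G~ x ≢ midpoint es e × tgt G~ x ≢ midpoint es e
  old-endpoints (inj₁ (s≡a , t≡b)) p = ≡old⇒≢midpoint s≡a p , ≡old⇒≢midpoint t≡b p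
  old-endpoints (inj₂ (s≡b , t≡a)) p = ≡old⇒≢midpoint s≡b p , ≡old⇒≢midpoint t≡a p

  joins-old-old : {x : EdgeId G~} {a b : Fin (nV G)} → Joins G~ x (old es a) (old es b) →
    Σ (EdgeId G) λ e → sgn G e ≡ neg × x ≡ half₁ es e × Joins G e a b
  joins-old-old {x} j with half-cover es x
  ... | inj₂ (e , p , refl) = ⊥-elim (proj₁ (old-endpoints j p) (src-half₂-pos p))
  ... | inj₁ (e , refl) with sgn G e in h
  ...   | pos = ⊥-elim (proj₂ (old-endpoints j h) (tgt-half₁-pos h))
  ...   | neg = e , h , refl , Sum.map unold unold j
    where
    unold : ∀ {c d} → src G~ x ≡ old es c × tgt G~ x ≡ old es d → src G e ≡ c × tgt G e ≡ d
    unold (s≡ , t≡) =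
      old-injective es (trans (sym src-half₁) s≡) , old-injective es (trans (sym (tgt-half₁-neg h)) t≡)

  module _ {e : EdgeId G} (p : sgn G e ≡ pos) where

    joins-midpoint : {x : EdgeId G~} {u : Fin (nV G~)} → Joins G~ x (midpoint es e) u →
      x ≡ half₁ es e ⊎ x ≡ half₂ es e
    joins-midpoint {x} j with half-cover es x | joins-endpoint {G = G~} j
    ... | inj₁ (_ , refl) | inj₁ src≡mid = ⊥-elim (old≢midpoint es e p (trans (sym src-half₁) src≡mid))
    ... | inj₁ (f , refl) | inj₂ tgt≡mid with sgn G f in q
    ...   | neg = ⊥-elim (old≢midpoint es e p (trans (sym (tgt-half₁-neg q)) tgt≡mid))
    ...   | pos = inj₁ (cong (half₁ es) (midpoint-injective es q p (trans (sym (tgt-half₁-pos q)) tgt≡mid)))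
    joins-midpoint j | inj₂ (_ , q , refl) | inj₁ src≡mid =
      inj₂ (cong (half₂ es) (midpoint-injective es q p (trans (sym (src-half₂-pos q)) src≡mid)))
    joins-midpoint j | inj₂ (_ , q , refl) | inj₂ tgt≡mid =
      ⊥-elim (old≢midpoint es e p (trans (sym (tgt-half₂-pos q)) tgt≡mid))

    midpoint-neighbour : {x : EdgeId G~} {u : Fin (nV G~)} → Joins G~ x (midpoint es e) u →
      Σ (Fin (nV G)) λ c → u ≡ old es c
    midpoint-neighbour j with joins-midpoint j
    ... | inj₁ refl = _ , trans (sym (joins-src {G = G~} j (tgt-half₁-pos p))) src-half₁
    ... | inj₂ refl = _ , trans (sym (joins-tgt {G = G~} j (src-half₂-pos p))) (tgt-half₂-pos p)

    src-from-half₁ : {a : Fin (nV G)} {u : Fin (nV G~)} → Joins G~ (half₁ es e) (old es a) u → src G e ≡ a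
    src-from-half₁ j with joins-endpoint {G = G~} j
    ... | inj₁ src≡a = old-injective es (trans (sym src-half₁) src≡a)
    ... | inj₂ tgt≡a = ⊥-elim (old≢midpoint es e p (trans (sym tgt≡a) (tgt-half₁-pos p)))

    tgt-from-half₂ : {a : Fin (nV G)} {u : Fin (nV G~)} → Joins G~ (half₂ es e) (old es a) u → tgt G e ≡ a
    tgt-from-half₂ j with joins-endpoint {G = G~} j
    ... | inj₁ src≡a = ⊥-elim (old≢midpoint es e p (trans (sym src≡a) (src-half₂-pos p)))
    ... | inj₂ tgt≡a = old-injective es (trans (sym (tgt-half₂-pos p)) tgt≡a)

  data Expands : List (Step G) → List (Step G~) → Set where
    []       : Expands [] []
    kept     : sgn G e ≡ neg → Expands xs ys →
               Expands ((v , e) ∷ xs) ((old es v , half₁ es e) ∷ ys)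
    forward  : sgn G e ≡ pos → Expands xs ys →
               Expands ((v , e) ∷ xs) ((old es v , half₁ es e) ∷ (midpoint es e , half₂ es e) ∷ ys)
    backward : sgn G e ≡ pos → Expands xs ys →
               Expands ((v , e) ∷ xs) ((old es v , half₂ es e) ∷ (midpoint es e , half₁ es e) ∷ ys)

  sgn-subdivide-pair : (x y : EdgeId G~) (s : Sign) → sgn G~ x ⊛ (sgn G~ y ⊛ s) ≡ s
  sgn-subdivide-pair x y s rewrite sgn-subdivide x | sgn-subdivide y = opposite-involutive s

  signOf-expands : Expands xs ys → signOf G~ ys ≡ signOf G xs
  signOf-expands []              = refl
  signOf-expands (kept h ex)     = cong₂ _⊛_ (trans (sgn-subdivide _) (sym h)) (signOf-expands ex)
  signOf-expands (forward h ex)  =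
    trans (sgn-subdivide-pair _ _ _) (trans (signOf-expands ex) (cong (_⊛ _) (sym h)))
  signOf-expands (backward h ex) =
    trans (sgn-subdivide-pair _ _ _) (trans (signOf-expands ex) (cong (_⊛ _) (sym h)))

  old-∈-expands : Expands xs ys → v ∈ map proj₁ xs → old es v ∈ map proj₁ ys
  old-∈-expands (kept _ _)     (here refl) = here refl
  old-∈-expands (forward _ _)  (here refl) = here refl
  old-∈-expands (backward _ _) (here refl) = here refl
  old-∈-expands (kept _ ex)     (there v∈) = there (old-∈-expands ex v∈)
  old-∈-expands (forward _ ex)  (there v∈) = there (there (old-∈-expands ex v∈))
  old-∈-expands (backward _ ex) (there v∈) = there (there (old-∈-expands ex v∈))

  half₁-∈-expands : Expands xs ys → e ∈ map proj₂ xs → half₁ es e ∈ map proj₂ ys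
  half₁-∈-expands (kept _ _)     (here refl) = here refl
  half₁-∈-expands (forward _ _)  (here refl) = here refl
  half₁-∈-expands (backward _ _) (here refl) = there (here refl)
  half₁-∈-expands (kept _ ex)     (there e∈) = there (half₁-∈-expands ex e∈)
  half₁-∈-expands (forward _ ex)  (there e∈) = there (there (half₁-∈-expands ex e∈))
  half₁-∈-expands (backward _ ex) (there e∈) = there (there (half₁-∈-expands ex e∈))

  parent-∈-expands : Expands xs ys → {x : EdgeId G~} → x ∈ map proj₂ ys → parent es x ∈ map proj₂ xs
  parent-∈-expands (kept _ _)     (here refl)         = here (parent-half₁ es _)
  parent-∈-expands (forward _ _)  (here refl)         = here (parent-half₁ es _)
  parent-∈-expands (forward _ _)  (there (here refl)) = here (parent-half₂ es _)
  parent-∈-expands (backward _ _) (here refl)         = here (parent-half₂ es _)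
  parent-∈-expands (backward _ _) (there (here refl)) = here (parent-half₁ es _)
  parent-∈-expands (kept _ ex)     (there x∈)         = there (parent-∈-expands ex x∈)
  parent-∈-expands (forward _ ex)  (there (there x∈)) = there (parent-∈-expands ex x∈)
  parent-∈-expands (backward _ ex) (there (there x∈)) = there (parent-∈-expands ex x∈)

  data Origin (xs : List (Step G)) (u : Fin (nV G~)) : Set where
    old-of : {v : Fin (nV G)} → v ∈ map proj₁ xs → u ≡ old es v → Origin xs u
    midpoint-of : {e : EdgeId G} → e ∈ map proj₂ xs → sgn G e ≡ pos → u ≡ midpoint es e → Origin xs u

  origin-∷ : {x : Step G} {xs : List (Step G)} {u : Fin (nV G~)} → Origin xs u → Origin (x ∷ xs) u
  origin-∷ (old-of v∈ u≡)           = old-of (there v∈) u≡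
  origin-∷ (midpoint-of e∈ h u≡)    = midpoint-of (there e∈) h u≡

  origin-expands : Expands xs ys →
    {u : Fin (nV G~)} → u ∈ map proj₁ ys → Origin xs u
  origin-expands (kept _ _)     (here u≡)          = old-of (here refl) u≡
  origin-expands (forward _ _)  (here u≡)          = old-of (here refl) u≡
  origin-expands (backward _ _) (here u≡)          = old-of (here refl) u≡
  origin-expands (forward h _)  (there (here u≡))  = midpoint-of (here refl) h u≡
  origin-expands (backward h _) (there (here u≡))  = midpoint-of (here refl) h u≡
  origin-expands (kept _ ex)     (there u∈)         = origin-∷ (origin-expands ex u∈)
  origin-expands (forward _ ex)  (there (there u∈)) = origin-∷ (origin-expands ex u∈)
  origin-expands (backward _ ex) (there (there u∈)) = origin-∷ (origin-expands ex u∈)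

  module _ (ex : Expands xs ys) where

    parent-∉-expands : {x : EdgeId G~} → e ∉ map proj₂ xs → parent es x ≡ e → x ∉ map proj₂ ys
    parent-∉-expands e∉ refl x∈ = e∉ (parent-∈-expands ex x∈)

    old-∉-expands : v ∉ map proj₁ xs → old es v ∉ map proj₁ ys
    old-∉-expands v∉ u∈ with origin-expands ex u∈
    ... | old-of v′∈ eq        = v∉ (subst (_∈ _) (sym (old-injective es eq)) v′∈)
    ... | midpoint-of _ h eq  = old≢midpoint es _ h eq

    midpoint-∉-expands : sgn G e ≡ pos → e ∉ map proj₂ xs → midpoint es e ∉ map proj₁ ys
    midpoint-∉-expands h e∉ u∈ with origin-expands ex u∈
    ... | old-of _ eq          = old≢midpoint es _ h (sym eq)
    ... | midpoint-of e′∈ h′ eq = e∉ (subst (_∈ _) (sym (midpoint-injective es h h′ eq)) e′∈)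

  unique-edges-expands : Expands xs ys → Unique (map proj₂ xs) → Unique (map proj₂ ys)
  unique-edges-expands []              _              = []
  unique-edges-expands (kept _ ex)     u@(_ ∷ unique) =
    unique-∷ (parent-∉-expands ex e∉ (parent-half₁ es _)) (unique-edges-expands ex unique)
    where e∉ = Unique[x∷xs]⇒x∉xs u
  unique-edges-expands (forward h ex)  u@(_ ∷ unique) =
    unique-∷ (λ { (here eq) → half₁≢half₂ h eq ; (there x∈) → h₁∉ x∈ })
             (unique-∷ h₂∉ (unique-edges-expands ex unique))
    where
    h₁∉ = parent-∉-expands ex (Unique[x∷xs]⇒x∉xs u) (parent-half₁ es _)
    h₂∉ = parent-∉-expands ex (Unique[x∷xs]⇒x∉xs u) (parent-half₂ es _)
  unique-edges-expands (backward h ex) u@(_ ∷ unique) =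
    unique-∷ (λ { (here eq) → half₁≢half₂ h (sym eq) ; (there x∈) → h₂∉ x∈ })
             (unique-∷ h₁∉ (unique-edges-expands ex unique))
    where
    h₁∉ = parent-∉-expands ex (Unique[x∷xs]⇒x∉xs u) (parent-half₁ es _)
    h₂∉ = parent-∉-expands ex (Unique[x∷xs]⇒x∉xs u) (parent-half₂ es _)

  unique-vertices-expands : Expands xs ys → Unique (map proj₁ xs) → Unique (map proj₂ xs) → Unique (map proj₁ ys)
  unique-vertices-expands []              _            _            = []
  unique-vertices-expands (kept _ ex)     uv@(_ ∷ uv′) (_ ∷ ue′)    =
    unique-∷ (old-∉-expands ex (Unique[x∷xs]⇒x∉xs uv)) (unique-vertices-expands ex uv′ ue′)
  unique-vertices-expands (forward h ex)  uv@(_ ∷ uv′) ue@(_ ∷ ue′) =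
    unique-∷ (λ { (here eq) → old≢midpoint es _ h eq ; (there u∈) → old∉ u∈ })
             (unique-∷ midpoint∉ (unique-vertices-expands ex uv′ ue′))
    where
    old∉      = old-∉-expands ex (Unique[x∷xs]⇒x∉xs uv)
    midpoint∉ = midpoint-∉-expands ex h (Unique[x∷xs]⇒x∉xs ue)
  unique-vertices-expands (backward h ex) uv@(_ ∷ uv′) ue@(_ ∷ ue′) =
    unique-∷ (λ { (here eq) → old≢midpoint es _ h eq ; (there u∈) → old∉ u∈ })
             (unique-∷ midpoint∉ (unique-vertices-expands ex uv′ ue′))
    where
    old∉      = old-∉-expands ex (Unique[x∷xs]⇒x∉xs uv)
    midpoint∉ = midpoint-∉-expands ex h (Unique[x∷xs]⇒x∉xs ue)

  unique-vertices-contracts : Expands xs ys → Unique (map proj₁ ys) → Unique (map proj₁ xs)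
  unique-vertices-contracts []              _                     = []
  unique-vertices-contracts (kept _ ex)     (old∉ ∷ unique)       =
    unique-∷ (λ v∈ → All.lookup old∉ (old-∈-expands ex v∈) refl) (unique-vertices-contracts ex unique)
  unique-vertices-contracts (forward _ ex)  ((_ ∷ old∉) ∷ _ ∷ unique) =
    unique-∷ (λ v∈ → All.lookup old∉ (old-∈-expands ex v∈) refl) (unique-vertices-contracts ex unique)
  unique-vertices-contracts (backward _ ex) ((_ ∷ old∉) ∷ _ ∷ unique) =
    unique-∷ (λ v∈ → All.lookup old∉ (old-∈-expands ex v∈) refl) (unique-vertices-contracts ex unique)

  unique-edges-contracts : Expands xs ys → Unique (map proj₂ ys) → Unique (map proj₂ xs)
  unique-edges-contracts []              _                          = []
  unique-edges-contracts (kept _ ex)     (half₁∉ ∷ unique)          =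
    unique-∷ (λ e∈ → All.lookup half₁∉ (half₁-∈-expands ex e∈) refl) (unique-edges-contracts ex unique)
  unique-edges-contracts (forward _ ex)  ((_ ∷ half₁∉) ∷ _ ∷ unique) =
    unique-∷ (λ e∈ → All.lookup half₁∉ (half₁-∈-expands ex e∈) refl) (unique-edges-contracts ex unique)
  unique-edges-contracts (backward _ ex) (_ ∷ half₁∉ ∷ unique)      =
    unique-∷ (λ e∈ → All.lookup half₁∉ (half₁-∈-expands ex e∈) refl) (unique-edges-contracts ex unique)

  expand-walk : {s t : Fin (nV G)} {xs : List (Step G)} → Walk G s xs t →
    Σ (List (Step G~)) λ ys → Expands xs ys × Walk G~ (old es s) ys (old es t)
  expand-walk [] = [] , [] , []
  expand-walk (_∷_ {e = e} j w) with expand-walk w | sgn G e in h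
  ... | ys , ex , w′ | neg = _ , kept h ex , joins-half₁-neg h j ∷ w′
  ... | ys , ex , w′ | pos with j
  ...   | inj₁ (s≡v , t≡u) = _ , forward h ex ,
          inj₁ (trans src-half₁ (cong (old es) s≡v) , tgt-half₁-pos h) ∷
          inj₁ (src-half₂-pos h , trans (tgt-half₂-pos h) (cong (old es) t≡u)) ∷ w′
  ...   | inj₂ (s≡u , t≡v) = _ , backward h ex ,
          inj₂ (src-half₂-pos h , trans (tgt-half₂-pos h) (cong (old es) t≡v)) ∷
          inj₂ (trans src-half₁ (cong (old es) s≡u) , tgt-half₁-pos h) ∷ w′

  contract-walk : {s t : Fin (nV G)} {ys : List (Step G~)} →
    Walk G~ (old es s) ys (old es t) → Unique (map proj₂ ys) →
    Σ (List (Step G)) λ xs → Expands xs ys × Walk G s xs t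

  contract-through-midpoint : {s t : Fin (nV G)} {e : EdgeId G} {x : EdgeId G~} {ys : List (Step G~)} →
    sgn G e ≡ pos → Joins G~ x (old es s) (midpoint es e) → All (x ≢_) (map proj₂ ys) →
    Walk G~ (midpoint es e) ys (old es t) → Unique (map proj₂ ys) →
    Σ (List (Step G)) λ xs → Expands xs ((old es s , x) ∷ ys) × Walk G s xs t

  contract-walk {ys = []} w _ = [] , [] , subst (Walk G _ []) (old-injective es (walk-[] w)) []
  contract-walk {ys = (u , x) ∷ ys} w (x∉ ∷ unique) with walk-∷ w
  ... | refl , m , j , w′ with vertex-cover es m
  ...   | inj₂ (e , p , refl) = contract-through-midpoint p j x∉ w′ unique
  ...   | inj₁ (c , refl) with joins-old-old j | contract-walk w′ unique
  ...     | e , h , refl , J | xs , ex , W = _ , kept h ex , J ∷ W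

  contract-through-midpoint {ys = []} p _ _ w _ = ⊥-elim (old≢midpoint es _ p (sym (walk-[] w)))
  -- The walk enters and leaves the midpoint of e along distinct edges, that is, along both halves of e.
  contract-through-midpoint {ys = (u , x₂) ∷ ys} p j (x≢x₂ ∷ _) w (_ ∷ unique) with walk-∷ w
  ... | refl , m , j₂ , w′ with midpoint-neighbour p j₂
  ...   | c , refl with contract-walk w′ unique | joins-midpoint p (joins-sym {G = G~} j) | joins-midpoint p j₂
  ...     | _ , _  , _ | inj₁ refl | inj₁ refl = ⊥-elim (x≢x₂ refl)
  ...     | _ , ex , W | inj₁ refl | inj₂ refl =
    _ , forward p ex , inj₁ (src-from-half₁ p j , tgt-from-half₂ p (joins-sym {G = G~} j₂)) ∷ W
  ...     | _ , ex , W | inj₂ refl | inj₁ refl =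
    _ , backward p ex , inj₂ (src-from-half₁ p (joins-sym {G = G~} j₂) , tgt-from-half₂ p j) ∷ W
  ...     | _ , _  , _ | inj₂ refl | inj₂ refl = ⊥-elim (x≢x₂ refl)

  -- A midpoint is sent to an endpoint of its edge, which lies on every circle through the midpoint.
  collapse : Fin (nV G~) → Fin (nV G)
  collapse u with vertex-cover es u
  ... | inj₁ (v , _)     = v
  ... | inj₂ (e , _ , _) = src G e

  collapse-old : (v : Fin (nV G)) → collapse (old es v) ≡ v
  collapse-old v with vertex-cover es (old es v)
  ... | inj₁ (_ , eq)     = sym (old-injective es eq)
  ... | inj₂ (e , p , eq) = ⊥-elim (old≢midpoint es e p eq)

  collapse-midpoint : {e : EdgeId G} → sgn G e ≡ pos → collapse (midpoint es e) ≡ src G e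
  collapse-midpoint {e} p with vertex-cover es (midpoint es e)
  ... | inj₁ (_ , eq)      = ⊥-elim (old≢midpoint es e p (sym eq))
  ... | inj₂ (_ , p′ , eq) = cong (src G) (midpoint-injective es p′ p (sym eq))

  expansion : CycleTransfer G G~
  expansion = record { vertexMap = collapse ; edgeMap = parent es ; transfer = expand-cycle }
    where
    expand-cycle : (c : Cycle G) → Σ (Cycle G~) λ d → CarriedBy G~ G collapse (parent es) (steps d) (steps c)
    expand-cycle (cycle b y ys w vertices-unique edges-unique) with expand-walk w
    ... | z ∷ zs , ex , w′ =
      cycle (old es b) z zs w′
        (unique-vertices-expands ex vertices-unique edges-unique) (unique-edges-expands ex edges-unique) ,
      signOf-expands ex , collapse-∈ , parent-∈-expands ex
      where
      collapse-∈ : {u : Fin (nV G~)} → u ∈ map proj₁ (z ∷ zs) → collapse u ∈ map proj₁ (y ∷ ys)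
      collapse-∈ u∈ with origin-expands ex u∈
      ... | old-of v∈ refl       = subst (_∈ _) (sym (collapse-old _)) v∈
      ... | midpoint-of e∈ p refl = subst (_∈ _) (sym (collapse-midpoint p)) (src-∈-closed w e∈)

  contract-closed : {s : Fin (nV G)} {y : Step G~} {ys : List (Step G~)} →
    Walk G~ (old es s) (y ∷ ys) (old es s) → Unique (map proj₁ (y ∷ ys)) → Unique (map proj₂ (y ∷ ys)) →
    Σ (Cycle G) λ d → CarriedBy G G~ (old es) (half₁ es) (steps d) (y ∷ ys)
  contract-closed w vertices-unique edges-unique with contract-walk w edges-unique
  ... | x ∷ xs , ex , W =
    cycle _ x xs W (unique-vertices-contracts ex vertices-unique) (unique-edges-contracts ex edges-unique) ,
    sym (signOf-expands ex) , old-∈-expands ex , half₁-∈-expands ex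

  contraction : CycleTransfer G~ G
  contraction = record { vertexMap = old es ; edgeMap = half₁ es ; transfer = contract-cycle }
    where
    contract-cycle : (c : Cycle G~) → Σ (Cycle G) λ d → CarriedBy G G~ (old es) (half₁ es) (steps d) (steps c)
    contract-cycle (cycle b y ys w vertices-unique edges-unique) with vertex-cover es b
    ... | inj₁ (_ , refl) = contract-closed w vertices-unique edges-unique
    -- A circle starting at a midpoint is first rotated to start at the next (old) vertex.
    ... | inj₂ (e , p , refl) with walk-∷ w
    ...   | refl , _ , j , w′ with midpoint-neighbour p j
    ...     | _ , refl with ys
    ...       | []      = ⊥-elim (old≢midpoint es e p (walk-[] w′))
    ...       | z ∷ zs  with contract-closed (walk-++ w′ (j ∷ []))
                           (unique-map-∷ʳ proj₁ (z ∷ zs) y vertices-unique)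
                           (unique-map-∷ʳ proj₂ (z ∷ zs) y edges-unique)
    ...         | d , carried = d , carriedBy-∷ʳ {G = G} {H = G~} (z ∷ zs) y carried

mainTheorem2 : (G : SignedGraph) (k : ℕ) →
    (IsFrustrationNumber (subdivide G) k ⇔ IsFrustrationNumber G k)
    × (IsFrustrationIndex (subdivide G) k ⇔ IsFrustrationIndex G k)
mainTheorem2 G k =
  mk⇔ (minimumSize-transfer (balancedDelVertices-⊑ expansion) (balancedDelVertices-⊑ contraction))
      (minimumSize-transfer (balancedDelVertices-⊑ contraction) (balancedDelVertices-⊑ expansion)) ,
  mk⇔ (minimumSize-transfer (balancedDelEdges-⊑ expansion) (balancedDelEdges-⊑ contraction))
      (minimumSize-transfer (balancedDelEdges-⊑ contraction) (balancedDelEdges-⊑ expansion))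
  where open Subdivision G using (expansion; contraction)
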